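{- For every finite string $\sigma$ over $A$ (repetitions allowed), the following equations are derivable in equational logic from $\mathrm{EqFFEL}^{\mathsf U}$: 1. $x\mathbin{\vee_\bullet}(y\mathbin{\wedge_\bullet}\mathsf U_\sigma)=(x\mathbin{\vee_\bullet}y)\mathbin{\wedge_\bullet}\mathsf U_\sigma$; 2. $x\mathbin{\vee_\bullet}(y\mathbin{\wedge_\bullet}\mathsf U_\sigma)=x\mathbin{\wedge_\bullet}(y\mathbin{\wedge_\bullet}\mathsf U_\sigma)$; 3. $\neg x\mathbin{\wedge_\bullet}(y\mathbin{\wedge_\bullet}\mathsf U_\sigma)=x\mathbin{\wedge_\bullet}(y\mathbin{\wedge_\bullet}\mathsf U_\sigma)$.
   Context: $A$ is a countable set of atoms. Terms are built from variables, constants $\mathsf T,\mathsf F,\mathsf U$, atoms $a\in A$, unary $\neg$ and binary $\mathbin{\wedge_\bullet},\mathbin{\vee_\bullet}$. For a string $\sigma\in A^*$, $\mathsf U_\sigma$ is defined by $\mathsf U_\epsilon=\mathsf U$ and $\mathsf U_{a\rho}=a\mathbin{\wedge_\bullet}\mathsf U_\rho$. $\mathrm{EqFFEL}^{\mathsf U}$ consists of: $\mathsf F=\neg\mathsf T$; $x\mathbin{\vee_\bullet}y=\neg(\neg x\mathbin{\wedge_\bullet}\neg y)$; $\neg\neg x=x$; $(x\mathbin{\wedge_\bullet}y)\mathbin{\wedge_\bullet}z=x\mathbin{\wedge_\bullet}(y\mathbin{\wedge_\bullet}z)$; $\mathsf T\mathbin{\wedge_\bullet}x=x$; $x\mathbin{\wedge_\bullet}\mathsf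 T=x$; $x\mathbin{\wedge_\bullet}\mathsf F=\mathsf F\mathbin{\wedge_\bullet}x$; $\neg x\mathbin{\wedge_\bullet}\mathsf F=x\mathbin{\wedge_\bullet}\mathsf F$; $(x\mathbin{\wedge_\bullet}\mathsf F)\mathbin{\vee_\bullet}y=(x\mathbin{\vee_\bullet}\mathsf T)\mathbin{\wedge_\bullet}y$; $x\mathbin{\vee_\bullet}(y\mathbin{\wedge_\bullet}\mathsf F)=x\mathbin{\wedge_\bullet}(y\mathbin{\vee_\bullet}\mathsf T)$; $\neg\mathsf U=\mathsf U$; $\mathsf U\mathbin{\wedge_\bullet}x=\mathsf U$. -}

module Defs where

open import Data.Nat using (ℕ)
open import Data.List using (List; []; _∷_)

data Term (A : Set) : Set where
  var  : ℕ → Term A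
  𝐓 𝐅 𝐔 : Term A
  atom : A → Term A
  ¬′_  : Term A → Term A
  _∧●_ : Term A → Term A → Term A
  _∨●_ : Term A → Term A → Term A

infix  9 ¬′_
infixr 7 _∧●_
infixr 6 _∨●_

module _ {A : Set} where

  _[_] : Term A → (ℕ → Term A) → Term A
  var n [ s ] = s n
  𝐓 [ s ] = 𝐓
  𝐅 [ s ] = 𝐅
  𝐔 [ s ] = 𝐔
  atom a [ s ] = atom a
  (¬′ t) [ s ] = ¬′ (t [ s ])
  (t ∧● u) [ s ] = (t [ s ]) ∧● (u [ s ])
  (t ∨● u) [ s ] = (t [ s ]) ∨● (u [ s ])

  U_ : List A → Term A
  U_ []      = 𝐔
  U_ (a ∷ ρ) = atom a ∧● U_ ρ

  private
    x y z : Term A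
    x = var 0
    y = var 1
    z = var 2

  data Axiom : Term A → Term A → Set where
    ax-F     : Axiom 𝐅 (¬′ 𝐓)
    ax-or    : Axiom (x ∨● y) (¬′ (¬′ x ∧● ¬′ y))
    ax-neg   : Axiom (¬′ ¬′ x) x
    ax-assoc : Axiom ((x ∧● y) ∧● z) (x ∧● (y ∧● z))
    ax-Tl    : Axiom (𝐓 ∧● x) x
    ax-Tr    : Axiom (x ∧● 𝐓) x
    ax-F1    : Axiom (x ∧● 𝐅) (𝐅 ∧● x)
    ax-F2    : Axiom (¬′ x ∧● 𝐅) (x ∧● 𝐅)
    ax-F3    : Axiom ((x ∧● 𝐅) ∨● y) ((x ∨● 𝐓) ∧● y)
    ax-F4    : Axiom (x ∨● (y ∧● 𝐅)) (x ∧● (y ∨● 𝐓))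
    ax-U1    : Axiom (¬′ 𝐔) 𝐔
    ax-U2    : Axiom (𝐔 ∧● x) 𝐔

  infix 4 ⊢_≐_
  data ⊢_≐_ : Term A → Term A → Set where
    axiom  : ∀ {l r} → Axiom l r → (s : ℕ → Term A) → ⊢ l [ s ] ≐ r [ s ]
    refl′  : ∀ {t} → ⊢ t ≐ t
    sym′   : ∀ {t u} → ⊢ t ≐ u → ⊢ u ≐ t
    trans′ : ∀ {t u v} → ⊢ t ≐ u → ⊢ u ≐ v → ⊢ t ≐ v
    cong¬  : ∀ {t u} → ⊢ t ≐ u → ⊢ ¬′ t ≐ ¬′ u
    cong∧  : ∀ {t t′ u u′} → ⊢ t ≐ t′ → ⊢ u ≐ u′ → ⊢ t ∧● u ≐ t′ ∧● u′
    cong∨  : ∀ {t t′ u u′} → ⊢ t ≐ t′ → ⊢ u ≐ u′ → ⊢ t ∨● u ≐ t′ ∨● u′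

-- Call a term V undefined-like if it absorbs everything to its right
-- (V ∧● t = V) and is fixed by negation (¬V = V).  𝐔 is undefined-like by
-- the 𝐔-axioms, and t ∧● V inherits both properties from V, so every 𝐔_σ is.
-- For an absorbing V the 𝐅-axioms collapse: 𝐅 ∧● V = V, hence ¬t ∧● V = t ∧● V
-- and t ∨● V = t ∧● ¬V.  With ¬V = V these give all three equations.
module Submission where

open import Defs
open import Data.Nat using (ℕ)
open import Data.List using (List; []; _∷_)
open import Data.Product using (_×_; _,_)
open import Function.Bundles using (_↣_)
open import Relation.Binary.Bundles using (Setoid)
import Relation.Binary.Reasoning.Setoid as SetoidReasoning

module _ {A : Set} where

  ≐-setoid : Setoid _ _
  ≐-setoid = record
    { Carrier       = Term A
    ; _≈_           = ⊢_≐_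
    ; isEquivalence = record { refl = refl′ ; sym = sym′ ; trans = trans′ }
    }

  open SetoidReasoning ≐-setoid

  ⟨_,_,_⟩ : Term A → Term A → Term A → ℕ → Term A
  ⟨ a , b , c ⟩ 0 = a
  ⟨ a , b , c ⟩ 1 = b
  ⟨ a , b , c ⟩ _ = c

  axiom₃ : ∀ {l r} → Axiom l r → (a b c : Term A) → ⊢ l [ ⟨ a , b , c ⟩ ] ≐ r [ ⟨ a , b , c ⟩ ]
  axiom₃ ax a b c = axiom ax ⟨ a , b , c ⟩

  Absorbing : Term A → Set
  Absorbing V = ∀ t → ⊢ V ∧● t ≐ V

  record UndefinedLike (V : Term A) : Set where
    field
      absorbing : Absorbing V
      ¬-fixed   : ⊢ ¬′ V ≐ V

  ¬𝐓≐𝐅 : ⊢ ¬′ 𝐓 ≐ 𝐅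
  ¬𝐓≐𝐅 = sym′ (axiom₃ ax-F 𝐓 𝐓 𝐓)

  module _ {V : Term A} (absorbs : Absorbing V) where

    𝐅∧●-absorbing : ⊢ 𝐅 ∧● V ≐ V
    𝐅∧●-absorbing = trans′ (sym′ (axiom₃ ax-F1 V 𝐓 𝐓)) (absorbs 𝐅)

    ¬∧●-absorbing : ∀ t → ⊢ ¬′ t ∧● V ≐ t ∧● V
    ¬∧●-absorbing t = begin
      ¬′ t ∧● V          ≈⟨ cong∧ refl′ 𝐅∧●-absorbing ⟨
      ¬′ t ∧● (𝐅 ∧● V)   ≈⟨ axiom₃ ax-assoc (¬′ t) 𝐅 V ⟨
      (¬′ t ∧● 𝐅) ∧● V   ≈⟨ cong∧ (axiom₃ ax-F2 t 𝐓 𝐓) refl′ ⟩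
      (t ∧● 𝐅) ∧● V      ≈⟨ axiom₃ ax-assoc t 𝐅 V ⟩
      t ∧● (𝐅 ∧● V)      ≈⟨ cong∧ refl′ 𝐅∧●-absorbing ⟩
      t ∧● V             ∎

    absorbing∨●𝐓 : ⊢ V ∨● 𝐓 ≐ ¬′ V
    absorbing∨●𝐓 = begin
      V ∨● 𝐓             ≈⟨ axiom₃ ax-or V 𝐓 𝐓 ⟩
      ¬′ (¬′ V ∧● ¬′ 𝐓)  ≈⟨ cong¬ (cong∧ refl′ ¬𝐓≐𝐅) ⟩
      ¬′ (¬′ V ∧● 𝐅)     ≈⟨ cong¬ (axiom₃ ax-F2 V 𝐓 𝐓) ⟩
      ¬′ (V ∧● 𝐅)        ≈⟨ cong¬ (absorbs 𝐅) ⟩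
      ¬′ V               ∎

    ∨●-absorbing : ∀ t → ⊢ t ∨● V ≐ t ∧● ¬′ V
    ∨●-absorbing t = begin
      t ∨● V             ≈⟨ cong∨ refl′ (absorbs 𝐅) ⟨
      t ∨● (V ∧● 𝐅)      ≈⟨ axiom₃ ax-F4 t V 𝐓 ⟩
      t ∧● (V ∨● 𝐓)      ≈⟨ cong∧ refl′ absorbing∨●𝐓 ⟩
      t ∧● ¬′ V          ∎

    ∧●-absorbing : ∀ t → Absorbing (t ∧● V)
    ∧●-absorbing t u = trans′ (axiom₃ ax-assoc t V u) (cong∧ refl′ (absorbs u))

  module _ {V : Term A} (V-undef : UndefinedLike V) where
    open UndefinedLike V-undef

    ∨●-undefinedLike : ∀ t → ⊢ t ∨● V ≐ t ∧● V
    ∨●-undefinedLike t = trans′ (∨●-absorbing absorbing t) (cong∧ refl′ ¬-fixed)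

    ∧●-undefinedLike : ∀ t → UndefinedLike (t ∧● V)
    ∧●-undefinedLike t = record
      { absorbing = ∧●-absorbing absorbing t
      ; ¬-fixed   = begin
          ¬′ (t ∧● V)            ≈⟨ cong¬ (cong∧ (sym′ (axiom₃ ax-neg t 𝐓 𝐓)) (sym′ ¬-fixed)) ⟩
          ¬′ (¬′ ¬′ t ∧● ¬′ V)   ≈⟨ axiom₃ ax-or (¬′ t) V 𝐓 ⟨
          ¬′ t ∨● V              ≈⟨ ∨●-undefinedLike (¬′ t) ⟩
          ¬′ t ∧● V              ≈⟨ ¬∧●-absorbing absorbing t ⟩
          t ∧● V                 ∎
      }

  ∨●-∧●-undefinedLike : ∀ {V} → UndefinedLike V → ∀ x y → ⊢ x ∨● (y ∧● V) ≐ (x ∨● y) ∧● V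
  ∨●-∧●-undefinedLike {V} V-undef x y = begin
    x ∨● (y ∧● V)              ≈⟨ ∨●-undefinedLike (∧●-undefinedLike V-undef y) x ⟩
    x ∧● (y ∧● V)              ≈⟨ ¬∧●-absorbing (∧●-absorbing absorbing y) x ⟨
    ¬′ x ∧● (y ∧● V)           ≈⟨ cong∧ refl′ (¬∧●-absorbing absorbing y) ⟨
    ¬′ x ∧● (¬′ y ∧● V)        ≈⟨ axiom₃ ax-assoc (¬′ x) (¬′ y) V ⟨
    (¬′ x ∧● ¬′ y) ∧● V        ≈⟨ ¬∧●-absorbing absorbing (¬′ x ∧● ¬′ y) ⟨
    ¬′ (¬′ x ∧● ¬′ y) ∧● V     ≈⟨ cong∧ (axiom₃ ax-or x y 𝐓) refl′ ⟨
    (x ∨● y) ∧● V              ∎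
    where open UndefinedLike V-undef using (absorbing)

  𝐔-undefinedLike : ∀ σ → UndefinedLike (U_ σ)
  𝐔-undefinedLike []      = record { absorbing = λ t → axiom₃ ax-U2 t 𝐓 𝐓 ; ¬-fixed = axiom₃ ax-U1 𝐓 𝐓 𝐓 }
  𝐔-undefinedLike (a ∷ σ) = ∧●-undefinedLike (𝐔-undefinedLike σ) (atom a)

lemma3p10 : (A : Set) → A ↣ ℕ → (σ : List A) →
    (⊢ (var 0) ∨● ((var 1) ∧● U_ σ) ≐ ((var 0) ∨● (var 1)) ∧● U_ σ)
    × (⊢ (var 0) ∨● ((var 1) ∧● U_ σ) ≐ (var 0) ∧● ((var 1) ∧● U_ σ))
    × (⊢ ¬′ (var 0) ∧● ((var 1) ∧● U_ σ) ≐ (var 0) ∧● ((var 1) ∧● U_ σ))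
lemma3p10 A _ σ =
    ∨●-∧●-undefinedLike U-undef (var 0) (var 1)
  , ∨●-undefinedLike yU-undef (var 0)
  , ¬∧●-absorbing (UndefinedLike.absorbing yU-undef) (var 0)
  where
  U-undef : UndefinedLike (U_ σ)
  U-undef = 𝐔-undefinedLike σ
  yU-undef : UndefinedLike (var 1 ∧● U_ σ)
  yU-undef = ∧●-undefinedLike U-undef (var 1)
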